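{- For each simple hypergraph $\mathcal{H}$, there exists a split graph $G$ such that $\mathcal{H}=\mathcal{S}(G)$, i.e. the hyperedges of $\mathcal{H}$ are exactly the minimal separators of $G$.
   Context: A hypergraph $\mathcal{H}$ is a pair $(V(\mathcal{H}),\mathcal{E}(\mathcal{H}))$ with $V(\mathcal{H})$ finite and $\mathcal{E}(\mathcal{H})\subseteq 2^{V(\mathcal{H})}\setminus\{\emptyset\}$; when clear, a hypergraph is identified with its set of hyperedges. It is simple if no hyperedge is a proper subset of another and $V(\mathcal{H})=\bigcup_{e\in\mathcal{E}(\mathcal{H})}e$. A split graph is a graph whose vertex set can be partitioned into a clique and an independent set. For a connected graph $G$, a separator is a set $S\subseteq V(G)$ such that the subgraph induced by $V(G)\setminus S$ is not connected; it is a minimal separator if it contains no other separator as a proper subset. $\mathcal{S}(G)$ is the hypergraph with vertex set $V(G)$ whose hyperedges are the minimal separators of $G$. -}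

module Defs where

open import Data.Nat using (ℕ)
open import Data.Bool using (Bool; true; false)
open import Data.Fin using (Fin)
open import Data.Fin.Subset using (Subset; _∈_; _∉_; _⊂_; Nonempty)
open import Data.List using (List)
import Data.List.Membership.Propositional as LM
open import Data.Product using (Σ; ∃; _×_)
open import Function.Bundles using (_⇔_)
open import Function.Definitions using (Injective)
open import Relation.Binary.PropositionalEquality using (_≡_)
open import Relation.Nullary using (¬_)

-- A hypergraph on vertex set Fin n, given by its (finite) list of hyperedges.
-- (Repetitions in the list are irrelevant: only list membership is used.)
record Hypergraph (n : ℕ) : Set where
  field
    edges    : List (Subset n)
    nonempty : ∀ {e} → e LM.∈ edges → Nonempty e
open Hypergraph public

IsSimple : ∀ {n} → Hypergraph n → Set
IsSimple {n} H =
  (∀ {e f} → e LM.∈ edges H → f LM.∈ edges H → ¬ (e ⊂ f))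
  × (∀ (x : Fin n) → ∃ λ e → (e LM.∈ edges H) × (x ∈ e))

record Graph (m : ℕ) : Set where
  field
    adj     : Fin m → Fin m → Bool
    adj-sym : ∀ u v → adj u v ≡ adj v u
    loopless : ∀ u → adj u u ≡ false
open Graph public

IsSplit : ∀ {m} → Graph m → Set
IsSplit {m} G = Σ (Subset m) λ K →
  (∀ u v → u ∈ K → v ∈ K → ¬ (u ≡ v) → adj G u v ≡ true)
  × (∀ u v → u ∉ K → v ∉ K → adj G u v ≡ false)

data Walk {m} (G : Graph m) (U : Subset m) : Fin m → Fin m → Set where
  here : ∀ {u} → u ∈ U → Walk G U u u
  step : ∀ {u w v} → u ∈ U → adj G u w ≡ true → Walk G U w v → Walk G U u v

-- The subgraph induced by U is connected (the empty graph counts as connected).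
ConnectedOn : ∀ {m} → Graph m → Subset m → Set
ConnectedOn G U = ∀ u v → u ∈ U → v ∈ U → Walk G U u v

Outside : ∀ {m} → Subset m → Subset m
Outside S = Data.Fin.Subset.∁ S

Connected : ∀ {m} → Graph m → Set
Connected G = ∀ u v → Walk G Data.Fin.Subset.⊤ u v

IsSeparator : ∀ {m} → Graph m → Subset m → Set
IsSeparator G S = ¬ ConnectedOn G (Outside S)

IsMinimalSeparator : ∀ {m} → Graph m → Subset m → Set
IsMinimalSeparator G S = IsSeparator G S × (∀ T → T ⊂ S → ¬ IsSeparator G T)

IsImage : ∀ {n m} → (Fin n → Fin m) → Subset n → Subset m → Set
IsImage ι e S = ∀ x → (x ∈ S) ⇔ (∃ λ y → (y ∈ e) × (ι y ≡ x))

-- The vertices of the hypergraph form a clique, and each hyperedge e contributes two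
-- non-adjacent "twin" vertices whose neighbourhood is exactly e.  Deleting e separates its
-- twins.  Conversely, if a set S contains no whole hyperedge, then every twin outside S keeps
-- a neighbour in the clique outside S, so the rest stays connected: every separator contains
-- a hyperedge.  Since the hyperedges form an antichain, the minimal separators are therefore
-- exactly the hyperedges.
module Submission where

open import Defs
open import Data.Bool using (Bool; true; false; not)
open import Data.Bool.Properties using (T-≡)
open import Data.Empty using (⊥-elim)
open import Data.Fin using (Fin; zero; suc; _≟_)
open import Data.Fin.Properties using (any?; all?; ¬∀⟶∃¬; +↔⊎; *↔×)
open import Data.Fin.Subset using (Subset; _∈_; _∉_; _⊆_; _⊂_; ∁; ⊤; Nonempty)
open import Data.Fin.Subset.Properties using (_∈?_; x∉p⇒x∈∁p; x∈∁p⇒x∉p; ∈⊤)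
open import Data.List using (List; length) renaming (lookup to lookupₗ)
import Data.List.Membership.Propositional as List
open import Data.List.Membership.Propositional.Properties using (∈-lookup)
open import Data.List.Relation.Unary.Any using (index)
open import Data.List.Relation.Unary.Any.Properties using (lookup-index)
open import Data.Nat using (ℕ; _+_; _*_)
open import Data.Product using (Σ; ∃; _×_; _,_; proj₁)
open import Data.Sum using (_⊎_; inj₁; inj₂)
open import Data.Sum.Properties using (inj₁-injective)
open import Data.Sum.Function.Propositional using (_⊎-↔_)
open import Data.Vec using (lookup; tabulate)
open import Data.Vec.Properties using ([]=⇒lookup; lookup⇒[]=; lookup∘tabulate)
open import Function.Bundles using (_⇔_; mk⇔; _↔_; Inverse; Equivalence)
open import Function.Definitions using (Injective)
open import Function.Properties.Inverse using (↔-refl; ↔-trans)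
open import Relation.Binary.PropositionalEquality
open import Relation.Nullary using (¬_; Dec; yes; no; does)
open import Relation.Nullary.Decidable using (isYes; toWitness; fromWitness; _×-dec_; _→-dec_)

IsClique : ∀ {m} → Graph m → Subset m → Set
IsClique G K = ∀ u v → u ∈ K → v ∈ K → ¬ u ≡ v → adj G u v ≡ true

module _ {m} {G : Graph m} {U : Subset m} where

  walk-head : ∀ {u v} → Walk G U u v → u ∈ U
  walk-head (here u∈U)     = u∈U
  walk-head (step u∈U _ _) = u∈U

  walk-last : ∀ {u v} → Walk G U u v → v ∈ U
  walk-last (here v∈U)      = v∈U
  walk-last (step _ _ walk) = walk-last walk

  infixr 5 _◅◅_
  _◅◅_ : ∀ {u v w} → Walk G U u v → Walk G U v w → Walk G U u w
  here _          ◅◅ walk′ = walk′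
  step u∈U a walk ◅◅ walk′ = step u∈U a (walk ◅◅ walk′)

  reverse : ∀ {u v} → Walk G U u v → Walk G U v u
  reverse (here u∈U)                = here u∈U
  reverse (step {u} {w} u∈U a walk) =
    reverse walk ◅◅ step (walk-head walk) (trans (adj-sym G w u) a) (here u∈U)

  clique-walk : ∀ {K c d} → IsClique G K → c ∈ K → d ∈ K → c ∈ U → d ∈ U → Walk G U c d
  clique-walk {c = c} {d} clique c∈K d∈K c∈U d∈U with c ≟ d
  ... | yes refl = here c∈U
  ... | no c≢d   = step c∈U (clique c d c∈K d∈K c≢d) (here d∈U)

  connectedOn-viaClique : ∀ K → IsClique G K →
                          (∀ {u} → u ∈ U → ∃ λ c → c ∈ K × Walk G U u c) → ConnectedOn G U
  connectedOn-viaClique K clique reach u v u∈U v∈U with reach u∈U | reach v∈U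
  ... | c , c∈K , u⇝c | d , d∈K , v⇝d =
    u⇝c ◅◅ clique-walk clique c∈K d∈K (walk-last u⇝c) (walk-last v⇝d) ◅◅ reverse v⇝d

  isolated⇒¬connectedOn : ∀ {u v} → u ∈ U → v ∈ U → ¬ u ≡ v →
                          (∀ w → adj G u w ≡ true → w ∉ U) → ¬ ConnectedOn G U
  isolated⇒¬connectedOn u∈U v∈U u≢v isolated connected with connected _ _ u∈U v∈U
  ... | here _                = u≢v refl
  ... | step {w = w} _ a walk = isolated w a (walk-head walk)

minimalSeparator-⊆ : ∀ {m} {G : Graph m} {S T} →
                     IsMinimalSeparator G S → T ⊆ S → IsSeparator G T → S ⊆ T
minimalSeparator-⊆ {T = T} (_ , minimal) T⊆S T-sep {x} x∈S with x ∈? T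
... | yes x∈T = x∈T
... | no  x∉T = ⊥-elim (minimal T (T⊆S , x , x∈S , x∉T) T-sep)

module _ {n m} (f : Fin n → Fin m) where

  image-contains? : ∀ e (x : Fin m) → Dec (∃ λ y → y ∈ e × f y ≡ x)
  image-contains? e x = any? λ y → y ∈? e ×-dec f y ≟ x

  image : Subset n → Subset m
  image e = tabulate λ x → isYes (image-contains? e x)

  image-isImage : ∀ e → IsImage f e (image e)
  image-isImage e x = mk⇔
    (λ x∈fe → toWitness {a? = image-contains? e x} (Equivalence.from T-≡
      (trans (sym (lookup∘tabulate _ x)) ([]=⇒lookup x∈fe))))
    (λ y↦x → lookup⇒[]= x (image e)
      (trans (lookup∘tabulate _ x) (Equivalence.to T-≡ (fromWitness {a? = image-contains? e x} y↦x))))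

  image-⊆ : ∀ {e S} → (∀ y → y ∈ e → f y ∈ S) → image e ⊆ S
  image-⊆ {e} e↦S x∈fe with Equivalence.to (image-isImage e _) x∈fe
  ... | y , y∈e , refl = e↦S y y∈e

  ⊆image⇒isImage : ∀ {e S} → (∀ y → y ∈ e → f y ∈ S) → S ⊆ image e → IsImage f e S
  ⊆image⇒isImage {e} e↦S S⊆fe x = mk⇔
    (λ x∈S → Equivalence.to (image-isImage e x) (S⊆fe x∈S))
    (λ { (y , y∈e , refl) → e↦S y y∈e })

  isImage-⊂ : Injective _≡_ _≡_ f → ∀ {e e′ S T} →
              IsImage f e S → T ⊂ S → (∀ y → y ∈ e′ → f y ∈ T) → e′ ⊂ e
  isImage-⊂ f-injective {e} {e′} S-img (T⊆S , x , x∈S , x∉T) e′↦T = e′⊆e , missed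
    where
    e′⊆e : e′ ⊆ e
    e′⊆e {y} y∈e′ with Equivalence.to (S-img (f y)) (T⊆S (e′↦T y y∈e′))
    ... | y′ , y′∈e , fy′≡fy = subst (_∈ e) (f-injective fy′≡fy) y′∈e
    missed : ∃ λ y → y ∈ e × y ∉ e′
    missed with Equivalence.to (S-img x) x∈S
    ... | y , y∈e , refl = y , y∈e , λ y∈e′ → x∉T (e′↦T y y∈e′)

module Construction {n} (hyperedges : List (Subset n)) where

  k : ℕ
  k = length hyperedges

  edge : Fin k → Subset n
  edge = lookupₗ hyperedges

  Vertex : Set
  Vertex = Fin n ⊎ (Fin 2 × Fin k)

  pattern point i  = inj₁ i
  pattern twin b j = inj₂ (b , j)

  m : ℕ
  m = n + 2 * k

  -- Opaque: only its inverse laws are used, and unfolding the Fin arithmetic exhausts memory.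
  opaque
    encoding : Fin m ↔ Vertex
    encoding = ↔-trans +↔⊎ (↔-refl ⊎-↔ *↔×)

  open Inverse encoding using (strictlyInverseˡ; strictlyInverseʳ)
    renaming (to to decode; from to code)

  code-injective : Injective _≡_ _≡_ code
  code-injective {a} {b} eq =
    trans (sym (strictlyInverseˡ a)) (trans (cong decode eq) (strictlyInverseˡ b))

  data Coded : Fin m → Set where
    coded : ∀ v → Coded (code v)

  view : ∀ u → Coded u
  view u = subst Coded (strictlyInverseʳ u) (coded (decode u))

  adjacent : Vertex → Vertex → Bool
  adjacent (point i)  (point i′) = not (does (i ≟ i′))
  adjacent (point i)  (twin _ j) = lookup (edge j) i
  adjacent (twin _ j) (point i)  = lookup (edge j) i
  adjacent (twin _ _) (twin _ _) = false

  adjacent-sym : ∀ a b → adjacent a b ≡ adjacent b a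
  adjacent-sym (point i)  (point i′) with i ≟ i′ | i′ ≟ i
  ... | yes _    | yes _    = refl
  ... | no  _    | no  _    = refl
  ... | yes i≡i′ | no  i′≢i = ⊥-elim (i′≢i (sym i≡i′))
  ... | no  i≢i′ | yes i′≡i = ⊥-elim (i≢i′ (sym i′≡i))
  adjacent-sym (point _)  (twin _ _) = refl
  adjacent-sym (twin _ _) (point _)  = refl
  adjacent-sym (twin _ _) (twin _ _) = refl

  adjacent-irrefl : ∀ a → adjacent a a ≡ false
  adjacent-irrefl (point i) with i ≟ i
  ... | yes _   = refl
  ... | no  i≢i = ⊥-elim (i≢i refl)
  adjacent-irrefl (twin _ _) = refl

  adjacent-points : ∀ {i i′} → ¬ i ≡ i′ → adjacent (point i) (point i′) ≡ true
  adjacent-points {i} {i′} i≢i′ with i ≟ i′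
  ... | yes i≡i′ = ⊥-elim (i≢i′ i≡i′)
  ... | no  _    = refl

  G : Graph m
  G = record
    { adj      = λ u v → adjacent (decode u) (decode v)
    ; adj-sym  = λ u v → adjacent-sym (decode u) (decode v)
    ; loopless = λ u → adjacent-irrefl (decode u)
    }

  adj-code : ∀ a b → adj G (code a) (code b) ≡ adjacent a b
  adj-code a b = cong₂ adjacent (strictlyInverseˡ a) (strictlyInverseˡ b)

  ι : Fin n → Fin m
  ι i = code (point i)

  ι-injective : Injective _≡_ _≡_ ι
  ι-injective eq = inj₁-injective (code-injective eq)

  points : Subset m
  points = image ι ⊤

  point∈points : ∀ i → ι i ∈ points
  point∈points i = Equivalence.from (image-isImage ι ⊤ (ι i)) (i , ∈⊤ , refl)

  points-clique : IsClique G points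
  points-clique u v u∈K v∈K u≢v
    with Equivalence.to (image-isImage ι ⊤ u) u∈K | Equivalence.to (image-isImage ι ⊤ v) v∈K
  ... | i , _ , refl | i′ , _ , refl =
    trans (adj-code (point i) (point i′)) (adjacent-points {i} {i′} λ { refl → u≢v refl })

  nonpoints-independent : ∀ u v → u ∉ points → v ∉ points → adj G u v ≡ false
  nonpoints-independent u v u∉K v∉K with view u | view v
  ... | coded (point i)  | _                = ⊥-elim (u∉K (point∈points i))
  ... | coded (twin _ _) | coded (point i)  = ⊥-elim (v∉K (point∈points i))
  ... | coded (twin b j) | coded (twin c l) = adj-code (twin b j) (twin c l)

  isSplit : IsSplit G
  isSplit = points , points-clique , nonpoints-independent

  MeetsEveryEdge : Subset m → Set
  MeetsEveryEdge U = ∀ j → ∃ λ y → y ∈ edge j × ι y ∈ U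

  meetsEveryEdge⇒connectedOn : ∀ {U} → MeetsEveryEdge U → ConnectedOn G U
  meetsEveryEdge⇒connectedOn {U} meets = connectedOn-viaClique points points-clique reach
    where
    reach : ∀ {u} → u ∈ U → ∃ λ c → c ∈ points × Walk G U u c
    reach {u} u∈U with view u
    ... | coded (point i) = ι i , point∈points i , here u∈U
    ... | coded (twin b j) with meets j
    ...   | y , y∈e , ιy∈U = ι y , point∈points y ,
            step u∈U (trans (adj-code (twin b j) (point y)) ([]=⇒lookup y∈e)) (here ιy∈U)

  connected : (∀ j → Nonempty (edge j)) → Connected G
  connected nonempty u v = meetsEveryEdge⇒connectedOn meets⊤ u v ∈⊤ ∈⊤
    where
    meets⊤ : MeetsEveryEdge ⊤
    meets⊤ j with nonempty j
    ... | y , y∈e = y , y∈e , ∈⊤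

  edge↦? : ∀ S j y → Dec (y ∈ edge j → ι y ∈ S)
  edge↦? S j y = y ∈? edge j →-dec ι y ∈? S

  separator⇒containsEdge : ∀ {S} → IsSeparator G S → ∃ λ j → ∀ y → y ∈ edge j → ι y ∈ S
  separator⇒containsEdge {S} S-sep with any? (λ j → all? (edge↦? S j))
  ... | yes contains = contains
  ... | no ¬contains = ⊥-elim (S-sep (meetsEveryEdge⇒connectedOn meets))
    where
    meets : MeetsEveryEdge (∁ S)
    meets j with ¬∀⟶∃¬ n _ (edge↦? S j) (λ edge↦S → ¬contains (j , edge↦S))
    ... | y , y↛S with y ∈? edge j
    ...   | yes y∈e = y , y∈e , x∉p⇒x∈∁p (λ ιy∈S → y↛S (λ _ → ιy∈S))
    ...   | no  y∉e = ⊥-elim (y↛S (λ y∈e → ⊥-elim (y∉e y∈e)))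

  twin∉image : ∀ {e S} b j → IsImage ι e S → code (twin b j) ∉ S
  twin∉image b j S-img twin∈S with Equivalence.to (S-img _) twin∈S
  ... | _ , _ , ιy≡twin with code-injective ιy≡twin
  ... | ()

  edgeImage-separator : ∀ {j S} → IsImage ι (edge j) S → IsSeparator G S
  edgeImage-separator {j} {S} S-img =
    isolated⇒¬connectedOn (outside zero) (outside (suc zero)) twins-distinct neighbours-in-S
    where
    outside : ∀ b → code (twin b j) ∈ ∁ S
    outside b = x∉p⇒x∈∁p (twin∉image b j S-img)

    twins-distinct : ¬ code (twin zero j) ≡ code (twin (suc zero) j)
    twins-distinct eq with code-injective eq
    ... | ()

    neighbours-in-S : ∀ w → adj G (code (twin zero j)) w ≡ true → w ∉ ∁ S
    neighbours-in-S w a with view w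
    ... | coded (point i) = λ ιi∈∁S → x∈∁p⇒x∉p ιi∈∁S (Equivalence.from (S-img (ι i))
            (i , lookup⇒[]= i (edge j) (trans (sym (adj-code (twin zero j) (point i))) a) , refl))
    ... | coded (twin b l) with () ← trans (sym a) (adj-code (twin zero j) (twin b l))

  Antichain : Set
  Antichain = ∀ {e f} → e List.∈ hyperedges → f List.∈ hyperedges → ¬ e ⊂ f

  edgeImage-minimal : Antichain → ∀ {j S} → IsImage ι (edge j) S → ∀ T → T ⊂ S → ¬ IsSeparator G T
  edgeImage-minimal antichain {j} S-img T T⊂S T-sep with separator⇒containsEdge T-sep
  ... | j′ , edge↦T =
    antichain (∈-lookup j′) (∈-lookup j) (isImage-⊂ ι ι-injective S-img T⊂S edge↦T)

  minimalSeparator⇒edgeImage : ∀ {S} → IsMinimalSeparator G S → ∃ λ j → IsImage ι (edge j) S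
  minimalSeparator⇒edgeImage S-min with separator⇒containsEdge (proj₁ S-min)
  ... | j , edge↦S = j , ⊆image⇒isImage ι edge↦S
    (minimalSeparator-⊆ S-min (image-⊆ ι edge↦S) (edgeImage-separator (image-isImage ι (edge j))))

  minimalSeparator⇔image : Antichain → ∀ S →
    IsMinimalSeparator G S ⇔ (∃ λ e → e List.∈ hyperedges × IsImage ι e S)
  minimalSeparator⇔image antichain S = mk⇔ toImage fromImage
    where
    toImage : IsMinimalSeparator G S → ∃ λ e → e List.∈ hyperedges × IsImage ι e S
    toImage S-min with minimalSeparator⇒edgeImage S-min
    ... | j , S-img = edge j , ∈-lookup j , S-img

    fromImage : (∃ λ e → e List.∈ hyperedges × IsImage ι e S) → IsMinimalSeparator G S
    fromImage (e , e∈H , S-img) = edgeImage-separator S-img′ , edgeImage-minimal antichain S-img′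
      where
      S-img′ : IsImage ι (edge (index e∈H)) S
      S-img′ = subst (λ f → IsImage ι f S) (lookup-index e∈H) S-img

corollary6p1 : ∀ (n : ℕ) (H : Hypergraph n) → IsSimple H →
    Σ ℕ λ m → Σ (Graph m) λ G → Σ (Fin n → Fin m) λ ι →
      Injective _≡_ _≡_ ι × IsSplit G × Connected G ×
      (∀ (S : Subset m) → IsMinimalSeparator G S ⇔ (∃ λ e → (e List.∈ edges H) × IsImage ι e S))
corollary6p1 n H (antichain , _) =
  m , G , ι , ι-injective , isSplit , connected (λ j → nonempty H (∈-lookup j)) ,
  minimalSeparator⇔image antichain
  where open Construction (edges H)
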